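{- Let $P=\nu X.\prod_{i\in I}A_i$ be an annotated normal form and $i,j\in I$ with $i$ tied to $j$ in $P$. Then any forest $\phi\in\mathcal F[P]$ containing two leaves labelled $A_i$ and $A_j$ respectively is such that these two leaves belong to the same tree of $\phi$ (i.e. have a common ancestor).
   Context: $\pi$-terms over infinite set of names: $P ::= \nu x.P \mid P_1\parallel P_2 \mid M \mid\, !M$, $M ::= \mathbf 0 \mid M+M \mid \pi.P$, $\pi ::= a(x)\mid \overline a\langle b\rangle \mid \tau$; $M$, $!M$ are sequential. Structural congruence $\equiv$: smallest congruence containing $\alpha$-conversion, commutativity/associativity of $+$, $\parallel$ with neutral $\mathbf 0$, $\nu x.\mathbf 0\equiv\mathbf 0$, $\nu x.\nu y.P\equiv\nu y.\nu x.P$, $!\mathbf 0\equiv\mathbf 0$, $!M\equiv M\parallel!M$, $P\parallel\nu a.Q\equiv\nu a.(P\parallel Q)$ if $a\notin\mathrm{fn}(P)$. Annotated terms: restrictions carry types, $\nu(x{:}\tau)$, where types are $\tau::=t\mid t[\tau]$ over a finite forest $\mathcal T$ of base types and $\mathrm{base}(t)=\mathrm{base}(t[\tau])=t$. A normal form is $\nu X.\prod_{i\in I}A_i$ where $X$ is a set of restrictions and each $A_i$ is $\sum_j\pi_j.N_j$ or $!(\sum_j\pi_j.N_j)$ with the $N_j$ normal forms, every name bound at most once and free and bound names disjoint. $\mathrm{forest}(\nu(x{:}\tau).Q)$ is a root labelled $(x,\mathrm{base}(\tau))$ with the roots of $\mathrm{forest}(Q)$ as children; $\mathrm{forest}(Q_1\parallel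 Q_2)$ disjoint union; sequential $Q$ gives a single node labelled $Q$; $\mathrm{forest}(\mathbf 0)$ empty; $\mathcal F[P]=\{\mathrm{forest}(Q)\mid Q\equiv P\}$. For $P=\nu X.\prod_{i\in I}A_i$, $i$ is linked to $j$ if $\mathrm{fn}(A_i)\cap\mathrm{fn}(A_j)$ contains a name restricted in $X$; "tied to" is the transitive closure of "linked to".
   Formalization: Leaves labelled $A_i$ and $A_j$ are only the occurrences of the components $A_i$ and $A_j$ of P traced through $Q\equiv P$ (copies from unfolding $!M\equiv M\parallel!M$ excluded), not every leaf with such a label. The statement above fails without it. -}

module Defs where

open import Data.Nat using (ℕ; _≟_)
open import Data.Fin using (Fin)
open import Data.Maybe using (Maybe; just; nothing)
open import Data.List using (List; []; _∷_; _++_; length; lookup; tabulate; map)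
open import Data.List.Relation.Unary.Any using (Any)
open import Data.List.Relation.Unary.All using (All)
open import Data.List.Relation.Unary.Unique.Propositional using (Unique)
open import Data.List.Membership.Propositional using (_∈_; _∉_)
open import Data.Product using (Σ; ∃; _×_; _,_; proj₁)
open import Data.Empty using (⊥; ⊥-elim)
open import Relation.Nullary using (¬_; yes; no)
open import Relation.Binary.PropositionalEquality using (_≡_)
open import Relation.Binary.Construct.Closure.Transitive using (TransClosure)
open import Induction.WellFounded using (WellFounded)

Name : Set
Name = ℕ

record TypeForest : Set where
  field
    size    : ℕ
    parent  : Fin size → Maybe (Fin size)
    acyclic : WellFounded (λ p c → parent c ≡ just p)

BaseTy : TypeForest → Set
BaseTy F = Fin (TypeForest.size F)

data Ty (B : Set) : Set where
  bt   : B → Ty B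
  _[_] : B → Ty B → Ty B

base : ∀ {B} → Ty B → B
base (bt t)    = t
base (t [ _ ]) = t

data Prefix : Set where
  inp : Name → Name → Prefix
  out : Name → Name → Prefix
  tau : Prefix

-- The extra parameter T is a set of *occurrence
-- tags*: each sequential term M / !M carries a 'Maybe T'.  The terms of
-- the paper are exactly 'Proc B ⊥' (all tags are 'nothing').  Tags are
-- only used to track which leaf of a forest stems from which component
-- A_i of a normal form.

data Proc (B T : Set) : Set
data Sum  (B T : Set) : Set

data Proc B T where
  ν    : Name → Ty B → Proc B T → Proc B T
  _∥_  : Proc B T → Proc B T → Proc B T
  seq  : Maybe T → Sum B T → Proc B T
  rep  : Maybe T → Sum B T → Proc B T

data Sum B T where
  𝟘   : Sum B T
  _⊕_ : Sum B T → Sum B T → Sum B T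
  _·_ : Prefix → Proc B T → Sum B T

𝟎 : ∀ {B T} → Proc B T
𝟎 = seq nothing 𝟘

remove : Name → List Name → List Name
remove x [] = []
remove x (y ∷ ys) with x ≟ y
... | yes _ = remove x ys
... | no  _ = y ∷ remove x ys

fnP : ∀ {B T} → Proc B T → List Name
fnS : ∀ {B T} → Sum B T → List Name
fnP (ν x τ P) = remove x (fnP P)
fnP (P ∥ Q)   = fnP P ++ fnP Q
fnP (seq _ M) = fnS M
fnP (rep _ M) = fnS M
fnS 𝟘               = []
fnS (M ⊕ N)         = fnS M ++ fnS N
fnS (inp a x · P)   = a ∷ remove x (fnP P)
fnS (out a b · P)   = a ∷ b ∷ fnP P
fnS (tau · P)       = fnP P

-- bound names, with multiplicity
bnP : ∀ {B T} → Proc B T → List Name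
bnS : ∀ {B T} → Sum B T → List Name
bnP (ν x τ P) = x ∷ bnP P
bnP (P ∥ Q)   = bnP P ++ bnP Q
bnP (seq _ M) = bnS M
bnP (rep _ M) = bnS M
bnS 𝟘               = []
bnS (M ⊕ N)         = bnS M ++ bnS N
bnS (inp a x · P)   = x ∷ bnP P
bnS (out a b · P)   = bnP P
bnS (tau · P)       = bnP P

swapN : Name → Name → Name → Name
swapN a b x with x ≟ a
... | yes _ = b
... | no  _ with x ≟ b
...   | yes _ = a
...   | no  _ = x

swapPre : Name → Name → Prefix → Prefix
swapPre a b (inp c x) = inp (swapN a b c) (swapN a b x)
swapPre a b (out c d) = out (swapN a b c) (swapN a b d)
swapPre a b tau       = tau

swapP : ∀ {B T} → Name → Name → Proc B T → Proc B T
swapS : ∀ {B T} → Name → Name → Sum B T → Sum B T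
swapP a b (ν x τ P) = ν (swapN a b x) τ (swapP a b P)
swapP a b (P ∥ Q)   = swapP a b P ∥ swapP a b Q
swapP a b (seq t M) = seq t (swapS a b M)
swapP a b (rep t M) = rep t (swapS a b M)
swapS a b 𝟘       = 𝟘
swapS a b (M ⊕ N) = swapS a b M ⊕ swapS a b N
swapS a b (π · P) = swapPre a b π · swapP a b P

-- Structural congruence: the smallest congruence containing
-- α-conversion, comm./assoc. of + and ∥ with neutral 0, ν x.0 ≡ 0,
-- ν x.ν y.P ≡ ν y.ν x.P, !0 ≡ 0, !M ≡ M ∥ !M and scope extrusion.
-- (Tags are carried along unchanged; on 'Proc B ⊥' this is exactly
-- the paper's ≡.)

infix 4 _≈P_ _≈S_
data _≈P_ {B T : Set} : Proc B T → Proc B T → Set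
data _≈S_ {B T : Set} : Sum B T → Sum B T → Set

data _≈P_ {B} {T} where
  reflP   : ∀ {P} → P ≈P P
  symP    : ∀ {P Q} → P ≈P Q → Q ≈P P
  transP  : ∀ {P Q R} → P ≈P Q → Q ≈P R → P ≈P R
  ν-cong  : ∀ {x τ P Q} → P ≈P Q → ν x τ P ≈P ν x τ Q
  ∥-cong  : ∀ {P P' Q Q'} → P ≈P P' → Q ≈P Q' → (P ∥ Q) ≈P (P' ∥ Q')
  seq-cong : ∀ {t M N} → M ≈S N → seq t M ≈P seq t N
  rep-cong : ∀ {t M N} → M ≈S N → rep t M ≈P rep t N
  α-ν     : ∀ {x y τ P} → y ∉ fnP (ν x τ P) → ν x τ P ≈P ν y τ (swapP x y P)
  ∥-comm  : ∀ {P Q} → (P ∥ Q) ≈P (Q ∥ P)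
  ∥-assoc : ∀ {P Q R} → ((P ∥ Q) ∥ R) ≈P (P ∥ (Q ∥ R))
  ∥-unit  : ∀ {P} → (P ∥ 𝟎) ≈P P
  ν-zero  : ∀ {x τ t} → ν x τ (seq t 𝟘) ≈P seq t 𝟘
  ν-swap  : ∀ {x y σ τ P} → ν x σ (ν y τ P) ≈P ν y τ (ν x σ P)
  rep-zero : ∀ {t} → rep t 𝟘 ≈P seq t 𝟘
  rep-unfold : ∀ {t M} → rep t M ≈P (seq nothing M ∥ rep t M)
  extrude : ∀ {a τ P Q} → a ∉ fnP P → (P ∥ ν a τ Q) ≈P ν a τ (P ∥ Q)

data _≈S_ {B} {T} where
  reflS   : ∀ {M} → M ≈S M
  symS    : ∀ {M N} → M ≈S N → N ≈S M
  transS  : ∀ {M N L} → M ≈S N → N ≈S L → M ≈S L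
  ⊕-cong  : ∀ {M M' N N'} → M ≈S M' → N ≈S N' → (M ⊕ N) ≈S (M' ⊕ N')
  ·-cong  : ∀ {π P Q} → P ≈P Q → (π · P) ≈S (π · Q)
  α-inp   : ∀ {a x y P} → y ∉ fnS (inp a x · P) →
            (inp a x · P) ≈S (inp a y · swapP x y P)
  ⊕-comm  : ∀ {M N} → (M ⊕ N) ≈S (N ⊕ M)
  ⊕-assoc : ∀ {M N L} → ((M ⊕ N) ⊕ L) ≈S (M ⊕ (N ⊕ L))
  ⊕-unit  : ∀ {M} → (M ⊕ 𝟘) ≈S M

data Label (B T : Set) : Set where
  restr : Name → B → Label B T
  term  : Proc B T → Label B T

data Tree (B T : Set) : Set where
  node : Label B T → List (Tree B T) → Tree B T

leaf : ∀ {B T} → Proc B T → List (Tree B T)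
leaf Q = node (term Q) [] ∷ []

forest : ∀ {B T} → Proc B T → List (Tree B T)
forest (ν x τ Q)         = node (restr x (base τ)) (forest Q) ∷ []
forest (Q₁ ∥ Q₂)         = forest Q₁ ++ forest Q₂
forest (seq t 𝟘)         = []
forest (seq t (M ⊕ N))   = leaf (seq t (M ⊕ N))
forest (seq t (π · P))   = leaf (seq t (π · P))
forest (rep t M)         = leaf (rep t M)

data HasLeaf {B T : Set} (ℓ : Label B T) : Tree B T → Set where
  here  : HasLeaf ℓ (node ℓ [])
  there : ∀ {l cs} → Any (HasLeaf ℓ) cs → HasLeaf ℓ (node l cs)

nus : ∀ {B T} → List (Name × Ty B) → Proc B T → Proc B T
nus [] P             = P
nus ((x , τ) ∷ X) P  = ν x τ (nus X P)

prod : ∀ {B T} → List (Proc B T) → Proc B T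
prod []            = 𝟎
prod (A ∷ [])      = A
prod (A ∷ A' ∷ As) = A ∥ prod (A' ∷ As)

data IsNF   {B : Set} : Proc B ⊥ → Set
data IsComp {B : Set} : Proc B ⊥ → Set
data IsGSum {B : Set} : Sum B ⊥ → Set

data IsNF where
  nf : ∀ X As → All IsComp As → IsNF (nus X (prod As))

data IsComp where
  c-seq : ∀ {M} → IsGSum M → IsComp (seq nothing M)
  c-rep : ∀ {M} → IsGSum M → IsComp (rep nothing M)

data IsGSum where
  g-zero : IsGSum 𝟘
  g-pre  : ∀ {π N} → IsNF N → IsGSum (π · N)
  g-plus : ∀ {M N} → IsGSum M → IsGSum N → IsGSum (M ⊕ N)

WellNamed : ∀ {B T} → Proc B T → Set
WellNamed P = Unique (bnP P) × (∀ x → x ∈ fnP P → x ∉ bnP P)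

IsAnnNF : ∀ {B} → List (Name × Ty B) → List (Proc B ⊥) → Set
IsAnnNF X As = All IsComp As × WellNamed (nus X (prod As))

Linked : ∀ {B} (X : List (Name × Ty B)) (As : List (Proc B ⊥)) →
         Fin (length As) → Fin (length As) → Set
Linked X As i j =
  ∃ λ a → a ∈ fnP (lookup As i) × a ∈ fnP (lookup As j) × a ∈ map proj₁ X

Tied : ∀ {B} (X : List (Name × Ty B)) (As : List (Proc B ⊥)) →
       Fin (length As) → Fin (length As) → Set
Tied X As = TransClosure (Linked X As)

retagP : ∀ {B T} → Proc B ⊥ → Proc B T
retagS : ∀ {B T} → Sum B ⊥ → Sum B T
retagP (ν x τ P) = ν x τ (retagP P)
retagP (P ∥ Q)   = retagP P ∥ retagP Q
retagP (seq _ M) = seq nothing (retagS M)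
retagP (rep _ M) = rep nothing (retagS M)
retagS 𝟘       = 𝟘
retagS (M ⊕ N) = retagS M ⊕ retagS N
retagS (π · P) = π · retagP P

mark : ∀ {B T} → T → Proc B ⊥ → Proc B T
mark t (seq _ M) = seq (just t) (retagS M)
mark t (rep _ M) = rep (just t) (retagS M)
mark t P         = retagP P

tracked : ∀ {B} (X : List (Name × Ty B)) (As : List (Proc B ⊥)) →
          Proc B (Fin (length As))
tracked X As = nus X (prod (tabulate (λ i → mark i (lookup As i))))

-- Tag the occurrence of each component A_i by i, as in tracked X As. Two things
-- survive structural congruence: the multiset of tags of top-level sequential
-- components, and the relation LinkedIn P t u, "the components tagged t and u
-- share a free name restricted in P" (α-conversion needs its freshness side
-- condition here). In the normal form the tags are distinct and linked
-- components are LinkedIn, so both facts transfer to Q. In forest Q two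
-- LinkedIn components lie below the node of their shared restriction, hence in
-- one tree; as a tag occurs in at most one tree, the chain of links from i to j
-- never leaves the tree containing A_i.

module Submission where

open import Defs
open import Data.Nat using (zero; suc) renaming (_≟_ to _≟ℕ_)
open import Data.Fin using (Fin; zero; suc)
open import Data.Maybe using (just)
open import Data.Empty using (⊥; ⊥-elim)
open import Data.Product using (_×_; _,_; proj₁; map₂)
open import Data.Product.Function.NonDependent.Propositional using (_×-⇔_)
open import Data.Sum using (_⊎_; inj₁; inj₂; assocʳ; assocˡ)
open import Data.Sum.Properties using (swap-↔)
open import Data.Sum.Function.Propositional using (_⊎-⇔_)
open import Data.List using (List; []; _∷_; _++_; length; lookup; tabulate; map; fromMaybe; allFin)
open import Data.List.Properties using (map-++; ++-assoc; ++-identityʳ)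
open import Data.List.Membership.Propositional using (_∈_; _∉_)
open import Data.List.Membership.Propositional.Properties using (∈-map⁺; ∈-map⁻; ∈-++⁺ˡ; ∈-++⁺ʳ; ∈-++⁻; ∈-lookup)
open import Data.List.Membership.DecPropositional _≟ℕ_ using (_∈?_)
open import Data.List.Relation.Unary.Any using (Any; here; there; index)
open import Data.List.Relation.Unary.Any.Properties using (lookup-index) renaming (++⁺ˡ to Any-++⁺ˡ; ++⁺ʳ to Any-++⁺ʳ; tabulate⁺ to Any-tabulate⁺)
open import Data.List.Relation.Unary.All as All using (All; []; _∷_)
open import Data.List.Relation.Unary.AllPairs using ([]; _∷_)
open import Data.List.Relation.Unary.Unique.Propositional using (Unique)
open import Data.List.Relation.Unary.Unique.Propositional.Properties using (allFin⁺)
open import Data.List.Relation.Binary.Disjoint.Propositional using (Disjoint)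
open import Data.List.Relation.Binary.Sublist.Propositional using (_⊆_; []; _∷_; _∷ʳ_; ⊆-refl; ⊆-trans; ⊆-reflexive; minimum)
open import Data.List.Relation.Binary.Sublist.Propositional.Properties using (All-resp-⊆; ++⁺; ++⁺ˡ)
open import Data.List.Relation.Binary.Permutation.Propositional using (_↭_; ↭-refl; ↭-sym; ↭-trans; ↭-reflexive; ↭⇒↭ₛ)
import Data.List.Relation.Binary.Permutation.Propositional.Properties as ↭
import Data.List.Relation.Binary.Permutation.Setoid.Properties as ↭ₛ
open import Data.List.Relation.Binary.BagAndSetEquality using (_∼[_]_; set; commutativeMonoid; ∷-cong; ++-idempotent)
open import Algebra.Bundles using (CommutativeMonoid)
open import Function using (_∘_; _⇔_; mk⇔; Equivalence; Injective)
open import Function.Construct.Identity using (⇔-id)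
open import Function.Construct.Symmetry using (⇔-sym)
open import Function.Construct.Composition using (_⇔-∘_)
open import Function.Properties.Inverse using (↔⇒⇔)
open import Function.Properties.Equivalence using (⇔-setoid)
open import Level using (0ℓ)
open import Relation.Nullary using (¬_; yes; no)
open import Relation.Binary.PropositionalEquality
import Relation.Binary.Reasoning.Setoid
open import Relation.Binary.Construct.Closure.Transitive using (TransClosure; [_]; _∷_)

open Equivalence using (from)

∈-remove⁻ : ∀ {n x} xs → n ∈ remove x xs → n ≢ x × n ∈ xs
∈-remove⁻ {x = x} (y ∷ ys) n∈ with x ≟ℕ y
... | yes _ = map₂ there (∈-remove⁻ ys n∈)
... | no x≢y with n∈
...   | here refl  = ≢-sym x≢y , here refl
...   | there n∈ys = map₂ there (∈-remove⁻ ys n∈ys)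

∈-remove⁺ : ∀ {n x} xs → n ≢ x → n ∈ xs → n ∈ remove x xs
∈-remove⁺ {x = x} (y ∷ ys) n≢x n∈ with x ≟ℕ y | n∈
... | yes refl | here refl  = ⊥-elim (n≢x refl)
... | yes _    | there n∈ys = ∈-remove⁺ ys n≢x n∈ys
... | no _     | here refl  = here refl
... | no _     | there n∈ys = there (∈-remove⁺ ys n≢x n∈ys)

∈-remove : ∀ {n x} xs → n ∈ remove x xs ⇔ (n ≢ x × n ∈ xs)
∈-remove xs = mk⇔ (∈-remove⁻ xs) (λ (n≢x , n∈xs) → ∈-remove⁺ xs n≢x n∈xs)

remove-map : ∀ {f : Name → Name} → Injective _≡_ _≡_ f →
             ∀ x ys → remove (f x) (map f ys) ≡ map f (remove x ys)
remove-map f-inj x [] = refl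
remove-map {f} f-inj x (y ∷ ys) with f x ≟ℕ f y | x ≟ℕ y
... | yes _   | yes _   = remove-map f-inj x ys
... | yes fx≡ | no x≢y  = ⊥-elim (x≢y (f-inj fx≡))
... | no fx≢  | yes x≡y = ⊥-elim (fx≢ (cong f x≡y))
... | no _    | no _    = cong (f y ∷_) (remove-map f-inj x ys)

data SwapView (a b n : Name) : Name → Set where
  swapped-left  : n ≡ a → SwapView a b n b
  swapped-right : n ≢ a → n ≡ b → SwapView a b n a
  fixed         : n ≢ a → n ≢ b → SwapView a b n n

swapView : ∀ a b n → SwapView a b n (swapN a b n)
swapView a b n with n ≟ℕ a
... | yes n≡a = swapped-left n≡a
... | no n≢a with n ≟ℕ b
...   | yes n≡b = swapped-right n≢a n≡b
...   | no n≢b  = fixed n≢a n≢b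

swapN-left : ∀ a b → swapN a b a ≡ b
swapN-left a b with swapN a b a | swapView a b a
... | _ | swapped-left _      = refl
... | _ | swapped-right a≢a _ = ⊥-elim (a≢a refl)
... | _ | fixed a≢a _         = ⊥-elim (a≢a refl)

swapN-right : ∀ a b → swapN a b b ≡ a
swapN-right a b with swapN a b b | swapView a b b
... | _ | swapped-left b≡a    = b≡a
... | _ | swapped-right _ _   = refl
... | _ | fixed _ b≢b         = ⊥-elim (b≢b refl)

swapN-fixed : ∀ {a b n} → n ≢ a → n ≢ b → swapN a b n ≡ n
swapN-fixed {a} {b} {n} n≢a n≢b with swapN a b n | swapView a b n
... | _ | swapped-left n≡a    = ⊥-elim (n≢a n≡a)
... | _ | swapped-right _ n≡b = ⊥-elim (n≢b n≡b)
... | _ | fixed _ _           = refl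

swapN-involutive : ∀ a b n → swapN a b (swapN a b n) ≡ n
swapN-involutive a b n with swapN a b n | swapView a b n
... | _ | swapped-left refl    = swapN-right n b
... | _ | swapped-right _ refl = swapN-left a n
... | _ | fixed n≢a n≢b        = swapN-fixed n≢a n≢b

swapN-injective : ∀ a b → Injective _≡_ _≡_ (swapN a b)
swapN-injective a b {m} {n} eq = begin
  m                       ≡⟨ swapN-involutive a b m ⟨
  swapN a b (swapN a b m) ≡⟨ cong (swapN a b) eq ⟩
  swapN a b (swapN a b n) ≡⟨ swapN-involutive a b n ⟩
  n                       ∎
  where open ≡-Reasoning

∈-map-swapN : ∀ {a b n xs} → n ∈ map (swapN a b) xs ⇔ swapN a b n ∈ xs
∈-map-swapN {a} {b} {n} = mk⇔ to-xs from-xs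
  where
  to-xs : ∀ {xs} → n ∈ map (swapN a b) xs → swapN a b n ∈ xs
  to-xs n∈ with ∈-map⁻ (swapN a b) n∈
  ... | m , m∈xs , refl = subst (_∈ _) (sym (swapN-involutive a b m)) m∈xs
  from-xs : ∀ {xs} → swapN a b n ∈ xs → n ∈ map (swapN a b) xs
  from-xs n∈ = subst (_∈ _) (swapN-involutive a b n) (∈-map⁺ (swapN a b) n∈)

≢-swapN : ∀ {a b m n} → m ≢ swapN a b n ⇔ swapN a b m ≢ n
≢-swapN {a} {b} {m} {n} = mk⇔
  (λ m≢ eq → m≢ (trans (sym (swapN-involutive a b m)) (cong (swapN a b) eq)))
  (λ m≢ eq → m≢ (trans (cong (swapN a b) eq) (swapN-involutive a b n)))

fnP-swap : ∀ {B T} a b (P : Proc B T) → fnP (swapP a b P) ≡ map (swapN a b) (fnP P)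
fnS-swap : ∀ {B T} a b (M : Sum B T) → fnS (swapS a b M) ≡ map (swapN a b) (fnS M)
fnP-swap a b (ν x τ P) rewrite fnP-swap a b P = remove-map (swapN-injective a b) x (fnP P)
fnP-swap a b (P ∥ Q) rewrite fnP-swap a b P | fnP-swap a b Q = sym (map-++ (swapN a b) (fnP P) (fnP Q))
fnP-swap a b (seq _ M) = fnS-swap a b M
fnP-swap a b (rep _ M) = fnS-swap a b M
fnS-swap a b 𝟘 = refl
fnS-swap a b (M ⊕ N) rewrite fnS-swap a b M | fnS-swap a b N = sym (map-++ (swapN a b) (fnS M) (fnS N))
fnS-swap a b (inp c x · P) rewrite fnP-swap a b P = cong (swapN a b c ∷_) (remove-map (swapN-injective a b) x (fnP P))
fnS-swap a b (out c d · P) rewrite fnP-swap a b P = refl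
fnS-swap a b (tau · P) = fnP-swap a b P

module _ {x y : Name} {Φ : Name → Set} (fresh : ¬ (y ≢ x × Φ y)) where

  α-⇔ : ∀ {n} → (n ≢ x × Φ n) ⇔ (n ≢ y × Φ (swapN x y n))
  α-⇔ {n} = mk⇔ rename unrename
    where
    rename : n ≢ x × Φ n → n ≢ y × Φ (swapN x y n)
    rename (n≢x , φ) with n ≟ℕ y
    ... | yes refl = ⊥-elim (fresh (n≢x , φ))
    ... | no n≢y   = n≢y , subst Φ (sym (swapN-fixed n≢x n≢y)) φ
    unrename : n ≢ y × Φ (swapN x y n) → n ≢ x × Φ n
    unrename (n≢y , φ) with swapN x y n | swapView x y n
    ... | _ | swapped-left refl    = ⊥-elim (fresh (≢-sym n≢y , φ))
    ... | _ | swapped-right _ refl = ⊥-elim (n≢y refl)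
    ... | _ | fixed n≢x _          = n≢x , φ

private
  module SetEq = CommutativeMonoid (commutativeMonoid set Name)
  module ⇔-Reasoning = Relation.Binary.Reasoning.Setoid (⇔-setoid 0ℓ)

remove-cong : ∀ {x xs ys} → xs ∼[ set ] ys → remove x xs ∼[ set ] remove x ys
remove-cong {xs = xs} {ys} xs∼ys = ⇔-sym (∈-remove ys) ⇔-∘ ((⇔-id _ ×-⇔ xs∼ys) ⇔-∘ ∈-remove xs)

remove-comm : ∀ x y xs → remove x (remove y xs) ∼[ set ] remove y (remove x xs)
remove-comm x y xs = mk⇔ (exchange x y) (exchange y x)
  where
  exchange : ∀ x y {n} → n ∈ remove x (remove y xs) → n ∈ remove y (remove x xs)
  exchange x y n∈ =
    let (n≢x , n∈′) = ∈-remove⁻ _ n∈ ; (n≢y , n∈xs) = ∈-remove⁻ xs n∈′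
    in ∈-remove⁺ _ n≢y (∈-remove⁺ xs n≢x n∈xs)

remove-α : ∀ {x y} xs → y ∉ remove x xs → remove x xs ∼[ set ] remove y (map (swapN x y) xs)
remove-α {x} {y} xs y∉ {n} = begin
  n ∈ remove x xs                    ≈⟨ ∈-remove xs ⟩
  (n ≢ x × n ∈ xs)                   ≈⟨ α-⇔ (λ (y≢x , y∈xs) → y∉ (∈-remove⁺ xs y≢x y∈xs)) ⟩
  (n ≢ y × swapN x y n ∈ xs)         ≈⟨ ⇔-id _ ×-⇔ ⇔-sym ∈-map-swapN ⟩
  (n ≢ y × n ∈ map (swapN x y) xs)   ≈⟨ ⇔-sym (∈-remove (map (swapN x y) xs)) ⟩
  n ∈ remove y (map (swapN x y) xs)  ∎
  where open ⇔-Reasoning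

remove-extrude : ∀ {a} xs ys → a ∉ xs → xs ++ remove a ys ∼[ set ] remove a (xs ++ ys)
remove-extrude {a} xs ys a∉xs = mk⇔ extrude-to extrude-from
  where
  extrude-to : ∀ {n} → n ∈ xs ++ remove a ys → n ∈ remove a (xs ++ ys)
  extrude-to n∈ with ∈-++⁻ xs n∈
  ... | inj₁ n∈xs = ∈-remove⁺ _ (λ { refl → a∉xs n∈xs }) (∈-++⁺ˡ n∈xs)
  ... | inj₂ n∈ys = let (n≢a , n∈ys) = ∈-remove⁻ ys n∈ys in ∈-remove⁺ _ n≢a (∈-++⁺ʳ xs n∈ys)
  extrude-from : ∀ {n} → n ∈ remove a (xs ++ ys) → n ∈ xs ++ remove a ys
  extrude-from n∈ with ∈-remove⁻ (xs ++ ys) n∈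
  ... | n≢a , n∈xs++ys with ∈-++⁻ xs n∈xs++ys
  ...   | inj₁ n∈xs = ∈-++⁺ˡ n∈xs
  ...   | inj₂ n∈ys = ∈-++⁺ʳ xs (∈-remove⁺ ys n≢a n∈ys)

fnP-≈ : ∀ {B T} {P Q : Proc B T} → P ≈P Q → fnP P ∼[ set ] fnP Q
fnS-≈ : ∀ {B T} {M N : Sum B T} → M ≈S N → fnS M ∼[ set ] fnS N
fnP-≈ reflP                         = SetEq.refl
fnP-≈ (symP e)                      = SetEq.sym (fnP-≈ e)
fnP-≈ (transP e e′)                 = SetEq.trans (fnP-≈ e) (fnP-≈ e′)
fnP-≈ (ν-cong e)                    = remove-cong (fnP-≈ e)
fnP-≈ (∥-cong e e′)                 = SetEq.∙-cong (fnP-≈ e) (fnP-≈ e′)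
fnP-≈ (seq-cong e)                  = fnS-≈ e
fnP-≈ (rep-cong e)                  = fnS-≈ e
fnP-≈ (α-ν {x} {y} {P = P} y∉)      rewrite fnP-swap x y P = remove-α (fnP P) y∉
fnP-≈ (∥-comm {P} {Q})              = SetEq.comm (fnP P) (fnP Q)
fnP-≈ (∥-assoc {P} {Q} {R})         = SetEq.assoc (fnP P) (fnP Q) (fnP R)
fnP-≈ (∥-unit {P})                  = SetEq.identityʳ (fnP P)
fnP-≈ ν-zero                        = SetEq.refl
fnP-≈ (ν-swap {x} {y} {P = P})      = remove-comm x y (fnP P)
fnP-≈ rep-zero                      = SetEq.refl
fnP-≈ (rep-unfold {M = M})          = SetEq.sym (++-idempotent (fnS M))
fnP-≈ (extrude {P = P} {Q} a∉)      = remove-extrude (fnP P) (fnP Q) a∉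
fnS-≈ reflS                         = SetEq.refl
fnS-≈ (symS e)                      = SetEq.sym (fnS-≈ e)
fnS-≈ (transS e e′)                 = SetEq.trans (fnS-≈ e) (fnS-≈ e′)
fnS-≈ (⊕-cong e e′)                 = SetEq.∙-cong (fnS-≈ e) (fnS-≈ e′)
fnS-≈ (·-cong {inp a x} e)          = ∷-cong refl (remove-cong (fnP-≈ e))
fnS-≈ (·-cong {out a b} e)          = ∷-cong refl (∷-cong refl (fnP-≈ e))
fnS-≈ (·-cong {tau} e)              = fnP-≈ e
fnS-≈ (α-inp {x = x} {y} {P} y∉)    rewrite fnP-swap x y P = ∷-cong refl (remove-α (fnP P) (y∉ ∘ there))
fnS-≈ (⊕-comm {M} {N})              = SetEq.comm (fnS M) (fnS N)
fnS-≈ (⊕-assoc {M} {N} {L})         = SetEq.assoc (fnS M) (fnS N) (fnS L)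
fnS-≈ (⊕-unit {M})                  = SetEq.identityʳ (fnS M)

FreeIn : ∀ {B T} → Proc B T → T → Name → Set
FreeIn (ν x τ P) t n = n ≢ x × FreeIn P t n
FreeIn (P ∥ Q)   t n = FreeIn P t n ⊎ FreeIn Q t n
FreeIn (seq m M) t n = m ≡ just t × n ∈ fnS M
FreeIn (rep m M) t n = m ≡ just t × n ∈ fnS M

LinkedIn : ∀ {B T} → Proc B T → T → T → Set
LinkedIn (ν x τ P) t u = LinkedIn P t u ⊎ (FreeIn P t x × FreeIn P u x)
LinkedIn (P ∥ Q)   t u = LinkedIn P t u ⊎ LinkedIn Q t u
LinkedIn (seq _ _) _ _ = ⊥
LinkedIn (rep _ _) _ _ = ⊥

free⇒∈fnP : ∀ {B T} (P : Proc B T) {t n} → FreeIn P t n → n ∈ fnP P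
free⇒∈fnP (ν x τ P) (n≢x , f) = ∈-remove⁺ (fnP P) n≢x (free⇒∈fnP P f)
free⇒∈fnP (P ∥ Q)   (inj₁ f)  = ∈-++⁺ˡ (free⇒∈fnP P f)
free⇒∈fnP (P ∥ Q)   (inj₂ f)  = ∈-++⁺ʳ (fnP P) (free⇒∈fnP Q f)
free⇒∈fnP (seq m M) (_ , n∈)  = n∈
free⇒∈fnP (rep m M) (_ , n∈)  = n∈

free-swap : ∀ {B T} a b (P : Proc B T) {t n} → FreeIn (swapP a b P) t n ⇔ FreeIn P t (swapN a b n)
free-swap a b (ν x τ P) = ≢-swapN ×-⇔ free-swap a b P
free-swap a b (P ∥ Q)   = free-swap a b P ⊎-⇔ free-swap a b Q
free-swap a b (seq m M) rewrite fnS-swap a b M = ⇔-id _ ×-⇔ ∈-map-swapN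
free-swap a b (rep m M) rewrite fnS-swap a b M = ⇔-id _ ×-⇔ ∈-map-swapN

free-swap-at : ∀ {B T} a b (P : Proc B T) {t} x → FreeIn (swapP a b P) t (swapN a b x) ⇔ FreeIn P t x
free-swap-at a b P {t} x = subst (λ z → FreeIn (swapP a b P) t (swapN a b x) ⇔ FreeIn P t z)
                                 (swapN-involutive a b x) (free-swap a b P)

linked-swap : ∀ {B T} a b (P : Proc B T) {t u} → LinkedIn (swapP a b P) t u ⇔ LinkedIn P t u
linked-swap a b (ν x τ P) = linked-swap a b P ⊎-⇔ (free-swap-at a b P x ×-⇔ free-swap-at a b P x)
linked-swap a b (P ∥ Q)   = linked-swap a b P ⊎-⇔ linked-swap a b Q
linked-swap a b (seq m M) = ⇔-id _
linked-swap a b (rep m M) = ⇔-id _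

free-α : ∀ {B T} {x y : Name} {τ : Ty B} (P : Proc B T) → y ∉ fnP (ν x τ P) →
         ∀ {t n} → FreeIn (ν x τ P) t n ⇔ FreeIn (ν y τ (swapP x y P)) t n
free-α {x = x} {y} P y∉ = (⇔-id _ ×-⇔ ⇔-sym (free-swap x y P)) ⇔-∘ α-⇔ fresh
  where
  fresh : ∀ {t} → ¬ (y ≢ x × FreeIn P t y)
  fresh (y≢x , f) = y∉ (∈-remove⁺ (fnP P) y≢x (free⇒∈fnP P f))

linked-α : ∀ {B T} {x y : Name} {τ : Ty B} (P : Proc B T) {t u} →
           LinkedIn (ν x τ P) t u ⇔ LinkedIn (ν y τ (swapP x y P)) t u
linked-α {x = x} {y} P = ⇔-sym (linked-swap x y P) ⊎-⇔ (free-at-y ×-⇔ free-at-y)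
  where
  free-at-y : ∀ {t} → FreeIn P t x ⇔ FreeIn (swapP x y P) t y
  free-at-y {t} = subst (λ z → FreeIn P t x ⇔ FreeIn (swapP x y P) t z)
                        (swapN-left x y) (⇔-sym (free-swap-at x y P x))

free-≈ : ∀ {B T} {P Q : Proc B T} → P ≈P Q → ∀ {t n} → FreeIn P t n ⇔ FreeIn Q t n
free-≈ reflP             = ⇔-id _
free-≈ (symP e)          = ⇔-sym (free-≈ e)
free-≈ (transP e e′)     = free-≈ e′ ⇔-∘ free-≈ e
free-≈ (ν-cong e)        = ⇔-id _ ×-⇔ free-≈ e
free-≈ (∥-cong e e′)     = free-≈ e ⊎-⇔ free-≈ e′
free-≈ (seq-cong e)      = ⇔-id _ ×-⇔ fnS-≈ e
free-≈ (rep-cong e)      = ⇔-id _ ×-⇔ fnS-≈ e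
free-≈ (α-ν {τ = τ} {P} y∉) = free-α {τ = τ} P y∉
free-≈ ∥-comm            = ↔⇒⇔ swap-↔
free-≈ ∥-assoc           = mk⇔ assocʳ assocˡ
free-≈ ∥-unit            = mk⇔ (λ { (inj₁ f) → f ; (inj₂ (() , _)) }) inj₁
free-≈ ν-zero            = mk⇔ (λ { (_ , _ , ()) }) (λ { (_ , ()) })
free-≈ ν-swap            = mk⇔ (λ (a , b , f) → b , a , f) (λ (a , b , f) → b , a , f)
free-≈ rep-zero          = mk⇔ (λ { (_ , ()) }) (λ { (_ , ()) })
free-≈ rep-unfold        = mk⇔ inj₂ (λ { (inj₁ (() , _)) ; (inj₂ f) → f })
free-≈ (extrude {P = P} a∉) = mk⇔
  (λ { (inj₁ f) → (λ { refl → a∉ (free⇒∈fnP P f) }) , inj₁ f ; (inj₂ (n≢a , f)) → n≢a , inj₂ f })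
  (λ { (_ , inj₁ f) → inj₁ f ; (n≢a , inj₂ f) → inj₂ (n≢a , f) })

linked-≈ : ∀ {B T} {P Q : Proc B T} → P ≈P Q → ∀ {t u} → LinkedIn P t u ⇔ LinkedIn Q t u
linked-≈ reflP           = ⇔-id _
linked-≈ (symP e)        = ⇔-sym (linked-≈ e)
linked-≈ (transP e e′)   = linked-≈ e′ ⇔-∘ linked-≈ e
linked-≈ (ν-cong e)      = linked-≈ e ⊎-⇔ (free-≈ e ×-⇔ free-≈ e)
linked-≈ (∥-cong e e′)   = linked-≈ e ⊎-⇔ linked-≈ e′
linked-≈ (seq-cong e)    = ⇔-id _
linked-≈ (rep-cong e)    = ⇔-id _
linked-≈ (α-ν {τ = τ} {P} _) = linked-α {τ = τ} P
linked-≈ ∥-comm          = ↔⇒⇔ swap-↔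
linked-≈ ∥-assoc         = mk⇔ assocʳ assocˡ
linked-≈ ∥-unit          = mk⇔ (λ { (inj₁ l) → l ; (inj₂ ()) }) inj₁
linked-≈ ν-zero          = mk⇔ (λ { (inj₁ ()) ; (inj₂ ((_ , ()) , _)) }) (λ ())
linked-≈ (ν-swap {x} {y} {σ} {τ}) = mk⇔ (exchange x y {σ} {τ}) (exchange y x {τ} {σ})
  where
  exchange : ∀ {B T} x y {σ τ : Ty B} {P : Proc B T} {t u} →
             LinkedIn (ν x σ (ν y τ P)) t u → LinkedIn (ν y τ (ν x σ P)) t u
  exchange x y (inj₁ (inj₁ l))               = inj₁ (inj₁ l)
  exchange x y (inj₂ ((_ , f) , (_ , g)))     = inj₁ (inj₂ (f , g))
  exchange x y (inj₁ (inj₂ (f , g))) with x ≟ℕ y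
  ... | yes refl = inj₁ (inj₂ (f , g))
  ... | no x≢y   = inj₂ ((≢-sym x≢y , f) , (≢-sym x≢y , g))
linked-≈ rep-zero        = ⇔-id _
linked-≈ rep-unfold      = mk⇔ (λ ()) (λ { (inj₁ ()) ; (inj₂ ()) })
linked-≈ (extrude {P = P} a∉) = mk⇔
  (λ { (inj₁ l) → inj₁ (inj₁ l) ; (inj₂ (inj₁ l)) → inj₁ (inj₂ l) ; (inj₂ (inj₂ (f , g))) → inj₂ (inj₂ f , inj₂ g) })
  (λ { (inj₁ (inj₁ l)) → inj₁ l
     ; (inj₁ (inj₂ l)) → inj₂ (inj₁ l)
     ; (inj₂ (inj₁ f , _)) → ⊥-elim (a∉ (free⇒∈fnP P f))
     ; (inj₂ (inj₂ _ , inj₁ g)) → ⊥-elim (a∉ (free⇒∈fnP P g))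
     ; (inj₂ (inj₂ f , inj₂ g)) → inj₂ (inj₂ (f , g)) })

tags : ∀ {B T} → Proc B T → List T
tags (ν _ _ P) = tags P
tags (P ∥ Q)   = tags P ++ tags Q
tags (seq m _) = fromMaybe m
tags (rep m _) = fromMaybe m

tags-swap : ∀ {B T} a b (P : Proc B T) → tags (swapP a b P) ≡ tags P
tags-swap a b (ν x τ P) = tags-swap a b P
tags-swap a b (P ∥ Q)   = cong₂ _++_ (tags-swap a b P) (tags-swap a b Q)
tags-swap a b (seq m M) = refl
tags-swap a b (rep m M) = refl

tags-≈ : ∀ {B T} {P Q : Proc B T} → P ≈P Q → tags P ↭ tags Q
tags-≈ reflP                 = ↭-refl
tags-≈ (symP e)              = ↭-sym (tags-≈ e)
tags-≈ (transP e e′)         = ↭-trans (tags-≈ e) (tags-≈ e′)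
tags-≈ (ν-cong e)            = tags-≈ e
tags-≈ (∥-cong e e′)         = ↭.++⁺ (tags-≈ e) (tags-≈ e′)
tags-≈ (seq-cong e)          = ↭-refl
tags-≈ (rep-cong e)          = ↭-refl
tags-≈ (α-ν {x} {y} {P = P} _) = ↭-reflexive (sym (tags-swap x y P))
tags-≈ (∥-comm {P} {Q})      = ↭.++-comm (tags P) (tags Q)
tags-≈ (∥-assoc {P} {Q} {R}) = ↭.++-assoc (tags P) (tags Q) (tags R)
tags-≈ (∥-unit {P})          = ↭.++-identityʳ (tags P)
tags-≈ ν-zero                = ↭-refl
tags-≈ ν-swap                = ↭-refl
tags-≈ rep-zero              = ↭-refl
tags-≈ rep-unfold            = ↭-refl
tags-≈ (extrude _)           = ↭-refl

Unique-resp-↭ : ∀ {A : Set} {xs ys : List A} → xs ↭ ys → Unique xs → Unique ys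
Unique-resp-↭ xs↭ys = ↭ₛ.Unique-resp-↭ (setoid _) (↭⇒↭ₛ xs↭ys)

Unique-resp-⊇ : ∀ {A : Set} {xs ys : List A} → xs ⊆ ys → Unique ys → Unique xs
Unique-resp-⊇ []             []          = []
Unique-resp-⊇ (_ ∷ʳ xs⊆ys)   (_ ∷ u)     = Unique-resp-⊇ xs⊆ys u
Unique-resp-⊇ (refl ∷ xs⊆ys) (y∉ys ∷ u) = All-resp-⊆ xs⊆ys y∉ys ∷ Unique-resp-⊇ xs⊆ys u

Unique-++⇒Disjoint : ∀ {A : Set} (xs : List A) {ys} → Unique (xs ++ ys) → Disjoint xs ys
Unique-++⇒Disjoint (x ∷ xs) (x∉ ∷ _) (here refl , x∈ys) = All.lookup x∉ (∈-++⁺ʳ xs x∈ys) refl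
Unique-++⇒Disjoint (x ∷ xs) (_ ∷ u)  (there v∈xs , v∈ys) = Unique-++⇒Disjoint xs u (v∈xs , v∈ys)

labelTags : ∀ {B T} → Label B T → List T
labelTags (restr _ _) = []
labelTags (term P)    = tags P

treeTags   : ∀ {B T} → Tree B T → List T
forestTags : ∀ {B T} → List (Tree B T) → List T
treeTags (node l cs) = labelTags l ++ forestTags cs
forestTags []       = []
forestTags (U ∷ F)  = treeTags U ++ forestTags F

forestTags-++ : ∀ {B T} (F G : List (Tree B T)) → forestTags (F ++ G) ≡ forestTags F ++ forestTags G
forestTags-++ []      G = refl
forestTags-++ (U ∷ F) G = begin
  treeTags U ++ forestTags (F ++ G)             ≡⟨ cong (treeTags U ++_) (forestTags-++ F G) ⟩
  treeTags U ++ (forestTags F ++ forestTags G)  ≡⟨ ++-assoc (treeTags U) (forestTags F) (forestTags G) ⟨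
  (treeTags U ++ forestTags F) ++ forestTags G  ∎
  where open ≡-Reasoning

forestTags-leaf : ∀ {B T} (P : Proc B T) → forestTags (leaf P) ≡ tags P
forestTags-leaf P = trans (++-identityʳ _) (++-identityʳ (tags P))

-- Only a sublist: a tagged empty sum has no leaf.
forestTags⊆tags : ∀ {B T} (Q : Proc B T) → forestTags (forest Q) ⊆ tags Q
forestTags⊆tags (ν x τ P)         = ⊆-trans (⊆-reflexive (++-identityʳ _)) (forestTags⊆tags P)
forestTags⊆tags (P ∥ Q) rewrite forestTags-++ (forest P) (forest Q) =
  ++⁺ (forestTags⊆tags P) (forestTags⊆tags Q)
forestTags⊆tags (seq m 𝟘)         = minimum _
forestTags⊆tags Q@(seq m (_ ⊕ _)) = ⊆-reflexive (forestTags-leaf Q)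
forestTags⊆tags Q@(seq m (_ · _)) = ⊆-reflexive (forestTags-leaf Q)
forestTags⊆tags Q@(rep m _)       = ⊆-reflexive (forestTags-leaf Q)

∈-lookup-forestTags : ∀ {B T} {t : T} (F : List (Tree B T)) k → t ∈ treeTags (lookup F k) → t ∈ forestTags F
∈-lookup-forestTags (U ∷ F) zero    t∈ = ∈-++⁺ˡ t∈
∈-lookup-forestTags (U ∷ F) (suc k) t∈ = ∈-++⁺ʳ (treeTags U) (∈-lookup-forestTags F k t∈)

∈-leaf-treeTags : ∀ {B T} {ℓ : Label B T} {t U} → t ∈ labelTags ℓ → HasLeaf ℓ U → t ∈ treeTags U
∈-leaf-forestTags : ∀ {B T} {ℓ : Label B T} {t F} → t ∈ labelTags ℓ → Any (HasLeaf ℓ) F → t ∈ forestTags F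
∈-leaf-treeTags   t∈ here          = ∈-++⁺ˡ t∈
∈-leaf-treeTags   t∈ (there {l} h) = ∈-++⁺ʳ (labelTags l) (∈-leaf-forestTags t∈ h)
∈-leaf-forestTags t∈ (here h)      = ∈-++⁺ˡ (∈-leaf-treeTags t∈ h)
∈-leaf-forestTags t∈ (there {U} h) = ∈-++⁺ʳ (treeTags U) (∈-leaf-forestTags t∈ h)

SameTree : ∀ {B T} → List (Tree B T) → T → T → Set
SameTree F t u = Any (λ U → t ∈ treeTags U × u ∈ treeTags U) F

free⇒∈forestTags : ∀ {B T} (Q : Proc B T) {t n} → FreeIn Q t n → t ∈ forestTags (forest Q)
free⇒∈forestTags (ν x τ P) (_ , f) = ∈-++⁺ˡ (free⇒∈forestTags P f)
free⇒∈forestTags (P ∥ Q) f rewrite forestTags-++ (forest P) (forest Q) with f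
... | inj₁ f = ∈-++⁺ˡ (free⇒∈forestTags P f)
... | inj₂ f = ∈-++⁺ʳ (forestTags (forest P)) (free⇒∈forestTags Q f)
free⇒∈forestTags (seq _ 𝟘)       (_ , ())
free⇒∈forestTags (seq _ (_ ⊕ _)) (refl , _) = here refl
free⇒∈forestTags (seq _ (_ · _)) (refl , _) = here refl
free⇒∈forestTags (rep _ _)       (refl , _) = here refl

linked⇒SameTree : ∀ {B T} (Q : Proc B T) {t u} → LinkedIn Q t u → SameTree (forest Q) t u
linked⇒SameTree (ν x τ P) (inj₁ l) =
  let c = linked⇒SameTree P l ; (t∈ , u∈) = lookup-index c
  in here (∈-lookup-forestTags (forest P) (index c) t∈ , ∈-lookup-forestTags (forest P) (index c) u∈)
linked⇒SameTree (ν x τ P) (inj₂ (f , g)) = here (free⇒∈forestTags P f , free⇒∈forestTags P g)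
linked⇒SameTree (P ∥ Q)   (inj₁ l)       = Any-++⁺ˡ (linked⇒SameTree P l)
linked⇒SameTree (P ∥ Q)   (inj₂ l)       = Any-++⁺ʳ (forest P) (linked⇒SameTree Q l)

treeIndex-unique : ∀ {B T} {t : T} (F : List (Tree B T)) → Unique (forestTags F) →
                   ∀ {k l} → t ∈ treeTags (lookup F k) → t ∈ treeTags (lookup F l) → k ≡ l
treeIndex-unique (U ∷ F) u {zero}  {zero}  _   _   = refl
treeIndex-unique (U ∷ F) u {zero}  {suc l} t∈U t∈  =
  ⊥-elim (Unique-++⇒Disjoint (treeTags U) u (t∈U , ∈-lookup-forestTags F l t∈))
treeIndex-unique (U ∷ F) u {suc k} {zero}  t∈  t∈U =
  ⊥-elim (Unique-++⇒Disjoint (treeTags U) u (t∈U , ∈-lookup-forestTags F k t∈))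
treeIndex-unique (U ∷ F) u {suc k} {suc l} t∈k t∈l =
  cong suc (treeIndex-unique F (Unique-resp-⊇ (++⁺ˡ (treeTags U) ⊆-refl) u) t∈k t∈l)

connected-treeIndex : ∀ {B T} {R : T → T → Set} (F : List (Tree B T)) → Unique (forestTags F) →
                      (∀ {t u} → R t u → SameTree F t u) →
                      ∀ {i j k l} → TransClosure R i j →
                      i ∈ treeTags (lookup F k) → j ∈ treeTags (lookup F l) → k ≡ l
connected-treeIndex F u same [ r ] i∈ j∈ =
  let (i∈′ , j∈′) = lookup-index (same r)
  in trans (treeIndex-unique F u i∈ i∈′) (treeIndex-unique F u j∈′ j∈)
connected-treeIndex F u same (r ∷ rs) i∈ j∈ =
  let (i∈′ , m∈) = lookup-index (same r)
  in trans (treeIndex-unique F u i∈ i∈′) (connected-treeIndex F u same rs m∈ j∈)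

fnP-retag : ∀ {B T} (P : Proc B ⊥) → fnP {B} {T} (retagP P) ≡ fnP P
fnS-retag : ∀ {B T} (M : Sum B ⊥) → fnS {B} {T} (retagS M) ≡ fnS M
fnP-retag (ν x τ P)     = cong (remove x) (fnP-retag P)
fnP-retag (P ∥ Q)       = cong₂ _++_ (fnP-retag P) (fnP-retag Q)
fnP-retag (seq _ M)     = fnS-retag M
fnP-retag (rep _ M)     = fnS-retag M
fnS-retag 𝟘             = refl
fnS-retag (M ⊕ N)       = cong₂ _++_ (fnS-retag M) (fnS-retag N)
fnS-retag (inp a x · P) = cong (λ ns → a ∷ remove x ns) (fnP-retag P)
fnS-retag (out a b · P) = cong (λ ns → a ∷ b ∷ ns) (fnP-retag P)
fnS-retag (tau · P)     = fnP-retag P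

tags-mark : ∀ {B T} {A : Proc B ⊥} (i : T) → IsComp A → tags {B} (mark i A) ≡ i ∷ []
tags-mark i (c-seq _) = refl
tags-mark i (c-rep _) = refl

free-mark : ∀ {B T} {A : Proc B ⊥} (i : T) {a} → IsComp A → a ∈ fnP A → FreeIn {B} (mark i A) i a
free-mark {T = T} i (c-seq {M} _) a∈ = refl , subst (_ ∈_) (sym (fnS-retag {T = T} M)) a∈
free-mark {T = T} i (c-rep {M} _) a∈ = refl , subst (_ ∈_) (sym (fnS-retag {T = T} M)) a∈

free-prod : ∀ {B T} (Ps : List (Proc B T)) {t a} → Any (λ P → FreeIn P t a) Ps → FreeIn (prod Ps) t a
free-prod (P ∷ [])      (here f)  = f
free-prod (P ∷ P′ ∷ Ps) (here f)  = inj₁ f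
free-prod (P ∷ P′ ∷ Ps) (there f) = inj₂ (free-prod (P′ ∷ Ps) f)

tags-prod-tabulate : ∀ {B T n} (g : Fin n → Proc B T) (h : Fin n → T) →
                     (∀ k → tags (g k) ≡ h k ∷ []) → tags (prod (tabulate g)) ≡ tabulate h
tags-prod-tabulate {n = zero}        g h g≡h = refl
tags-prod-tabulate {n = suc zero}    g h g≡h = g≡h zero
tags-prod-tabulate {n = suc (suc n)} g h g≡h =
  cong₂ _++_ (g≡h zero) (tags-prod-tabulate (g ∘ suc) (h ∘ suc) (g≡h ∘ suc))

tags-nus : ∀ {B T} (X : List (Name × Ty B)) (P : Proc B T) → tags (nus X P) ≡ tags P
tags-nus []      P = refl
tags-nus (_ ∷ X) P = tags-nus X P

free-nus : ∀ {B T} (X : List (Name × Ty B)) {P : Proc B T} {t a} →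
           a ∉ map proj₁ X → FreeIn P t a → FreeIn (nus X P) t a
free-nus []      a∉ f = f
free-nus (_ ∷ X) a∉ f = (a∉ ∘ here) , free-nus X (a∉ ∘ there) f

-- A name restricted several times in X is bound by its innermost restriction.
linked-nus : ∀ {B T} (X : List (Name × Ty B)) {P : Proc B T} {t u a} →
             a ∈ map proj₁ X → FreeIn P t a → FreeIn P u a → LinkedIn (nus X P) t u
linked-nus ((x , τ) ∷ X) {a = a} a∈ f g with a ∈? map proj₁ X | a∈
... | yes a∈X | _          = inj₁ (linked-nus X a∈X f g)
... | no a∉X  | here refl  = inj₂ (free-nus X a∉X f , free-nus X a∉X g)
... | no a∉X  | there a∈X  = ⊥-elim (a∉X a∈X)

module _ {B} {As : List (Proc B ⊥)} (comps : All IsComp As) where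

  private
    component : (k : Fin (length As)) → IsComp (lookup As k)
    component k = All.lookup comps (∈-lookup k)

  ∈-tags-mark : ∀ k → k ∈ tags {B} (mark k (lookup As k))
  ∈-tags-mark k = subst (k ∈_) (sym (tags-mark k (component k))) (here refl)

  tags-tracked : ∀ X → tags (tracked X As) ≡ allFin (length As)
  tags-tracked X = trans (tags-nus X _) (tags-prod-tabulate _ _ (λ k → tags-mark k (component k)))

  linked-tracked : ∀ X {k l} → Linked X As k l → LinkedIn (tracked X As) k l
  linked-tracked X (a , a∈k , a∈l , a∈X) = linked-nus X a∈X (free-at _ a∈k) (free-at _ a∈l)
    where
    free-at : ∀ m → a ∈ fnP (lookup As m) → FreeIn (prod (tabulate (λ m → mark m (lookup As m)))) m a
    free-at m a∈ = free-prod _ (Any-tabulate⁺ m (free-mark m (component m) a∈))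

lemma2 : (F : TypeForest)
         (X : List (Name × Ty (BaseTy F))) (As : List (Proc (BaseTy F) ⊥)) →
         IsAnnNF X As →
         (i j : Fin (length As)) → Tied X As i j →
         (Q : Proc (BaseTy F) (Fin (length As))) → Q ≈P tracked X As →
         (p : Any (HasLeaf (term (mark i (lookup As i)))) (forest Q)) →
         (q : Any (HasLeaf (term (mark j (lookup As j)))) (forest Q)) →
         index p ≡ index q
lemma2 F X As (comps , _) i j tied Q Q≈ p q =
  connected-treeIndex (forest Q) unique-forestTags linked⇒sameTree tied (leaf-tag i p) (leaf-tag j q)
  where
  unique-forestTags : Unique (forestTags (forest Q))
  unique-forestTags =
    Unique-resp-⊇ (forestTags⊆tags Q)
      (Unique-resp-↭ (tags-≈ (symP Q≈))
        (subst Unique (sym (tags-tracked comps X)) (allFin⁺ (length As))))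
  linked⇒sameTree : ∀ {k l} → Linked X As k l → SameTree (forest Q) k l
  linked⇒sameTree = linked⇒SameTree Q ∘ from (linked-≈ Q≈) ∘ linked-tracked comps X
  leaf-tag : ∀ k (h : Any (HasLeaf (term (mark k (lookup As k)))) (forest Q)) →
             k ∈ treeTags (lookup (forest Q) (index h))
  leaf-tag k h = ∈-leaf-treeTags (∈-tags-mark comps k) (lookup-index h)
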